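{- Let $\mathcal{G}$ be a nontrivial class of graphs (i.e., $\mathcal{G}\neq\emptyset$, $\mathcal{G}$ does not consist only of the empty graph, and $\mathcal{G}$ is not the set of all graphs). If $\mathcal{G}$ has bounded treewidth, then $\mathcal{G}$ is not closed under path-addition.
   Context: All graphs are finite, simple and undirected; $|G|$ denotes the number of vertices of $G$. Path-addition: let $G=(V,E)$ be a graph, $u,v\in V$, and let $P=(u,w_1,\ldots,w_t,v)$ be a path from $u$ to $v$ whose internal vertices $W=\{w_1,\ldots,w_t\}$ are new vertices (not in $V$). Let $Q$ be the set of edges of $P$ and $F$ a set of edges each having at least one endpoint in $W$. Then $G\oplus P\oplus F=(V\cup W,E\cup Q\cup F)$. A class $\mathcal{G}$ is closed under path-addition if for every $G\in\mathcal{G}$, every two vertices $u,v$ of $G$ and every such path $P$ of length at least $|G|-1$ between $u$ and $v$, there is a set $F$ of such supplementary edges with $G\oplus P\oplus F\in\mathcal{G}$; if $\mathcal{G}$ is hereditary (closed under induced subgraphs), one requires $F=\emptyset$. A class has bounded treewidth if there is a constant bounding the treewidth of all its members. -}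

module Defs where

open import Data.Bool using (Bool; true; false; _∧_; _∨_; not)
open import Data.Bool.Properties using (∨-comm; ∧-zeroʳ)
open import Data.Nat using (ℕ; zero; suc; _≤_; _∸_; _≡ᵇ_)
open import Data.Fin using (Fin; toℕ; splitAt; _≟_)
open import Data.Fin.Subset using (Subset; _∈_; ∣_∣)
open import Data.Unit using (⊤)
open import Data.Sum using (_⊎_; inj₁; inj₂)
open import Data.Product using (Σ; ∃; _×_; _,_)
open import Data.List using (List; []; _∷_; _++_; [_]; length)
open import Data.List.Relation.Unary.Linked using (Linked)
open import Data.List.Relation.Unary.Unique.Propositional using (Unique)
open import Function.Definitions using (Injective; Bijective)
open import Relation.Nullary using (¬_; yes; no)
open import Relation.Nullary.Decidable using (⌊_⌋)
open import Relation.Binary.PropositionalEquality using (_≡_; _≢_; refl; sym; cong₂)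

record Graph : Set where
  field
    size   : ℕ
    adj    : Fin size → Fin size → Bool
    adj-sym    : ∀ x y → adj x y ≡ adj y x
    adj-irrefl : ∀ x → adj x x ≡ false
open Graph public

Edge : (G : Graph) → Fin (size G) → Fin (size G) → Set
Edge G x y = adj G x y ≡ true

GraphClass : Set₁
GraphClass = Graph → Set

Iso : Graph → Graph → Set
Iso H G = Σ (Fin (size H) → Fin (size G)) λ f →
  Bijective _≡_ _≡_ f × (∀ i j → adj H i j ≡ adj G (f i) (f j))

InducedSubgraph : Graph → Graph → Set
InducedSubgraph H G = Σ (Fin (size H) → Fin (size G)) λ f →
  Injective _≡_ _≡_ f × (∀ i j → adj H i j ≡ adj G (f i) (f j))

IsoClosed : GraphClass → Set
IsoClosed 𝒢 = ∀ G H → Iso H G → 𝒢 G → 𝒢 H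

Hereditary : GraphClass → Set
Hereditary 𝒢 = ∀ G H → InducedSubgraph H G → 𝒢 G → 𝒢 H

Nontrivial : GraphClass → Set
Nontrivial 𝒢 =
  (∃ λ G → 𝒢 G) ×
  ¬ (∀ G → 𝒢 G → size G ≡ 0) ×
  ¬ (∀ G → 𝒢 G)

data Reach (G : Graph) (P : Fin (size G) → Set) : Fin (size G) → Fin (size G) → Set where
  here : ∀ {x} → P x → Reach G P x x
  step : ∀ {x y z} → P x → Edge G x y → Reach G P y z → Reach G P x z

Connected : Graph → Set
Connected G = ∀ x y → Reach G (λ _ → ⊤) x y

HasCycle : Graph → Set
HasCycle G = Σ (Fin (size G)) λ x → Σ (List (Fin (size G))) λ ys →
  2 ≤ length ys × Unique (x ∷ ys) × Linked (Edge G) (x ∷ ys ++ [ x ])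

IsTree : Graph → Set
IsTree T = 1 ≤ size T × Connected T × ¬ HasCycle T

record TreeDecomposition (G : Graph) (k : ℕ) : Set where
  field
    tree    : Graph
    isTree  : IsTree tree
    bag     : Fin (size tree) → Subset (size G)
    covers-vertices : ∀ v → ∃ λ s → v ∈ bag s
    covers-edges    : ∀ u v → Edge G u v → ∃ λ s → u ∈ bag s × v ∈ bag s
    connected-occurrences : ∀ v s s′ → v ∈ bag s → v ∈ bag s′ →
                              Reach tree (λ r → v ∈ bag r) s s′
    -- width ≤ k : every bag has at most k + 1 vertices
    width≤ : ∀ s → ∣ bag s ∣ ≤ suc k

TreewidthAtMost : Graph → ℕ → Set
TreewidthAtMost G k = TreeDecomposition G k

BoundedTreewidth : GraphClass → Set
BoundedTreewidth 𝒢 = ∃ λ k → ∀ G → 𝒢 G → TreewidthAtMost G k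

eqb : ∀ {n} → Fin n → Fin n → Bool
eqb x y = ⌊ x ≟ y ⌋

eqb-sym : ∀ {n} (x y : Fin n) → eqb x y ≡ eqb y x
eqb-sym x y with x ≟ y | y ≟ x
... | yes _ | yes _ = refl
... | no _  | no _  = refl
... | yes p | no ¬q = Data.Empty.⊥-elim (¬q (sym p)) where import Data.Empty
... | no ¬p | yes q = Data.Empty.⊥-elim (¬p (sym q)) where import Data.Empty

eqb-refl : ∀ {n} (x : Fin n) → eqb x x ≡ true
eqb-refl x with x ≟ x
... | yes _ = refl
... | no ¬p = Data.Empty.⊥-elim (¬p refl) where import Data.Empty

mkGraph : (n : ℕ) → (Fin n → Fin n → Bool) → Graph
mkGraph n R = record
  { size = n
  ; adj = λ x y → (R x y ∨ R y x) ∧ not (eqb x y)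
  ; adj-sym = λ x y → cong₂ (λ a b → a ∧ not b) (∨-comm (R x y) (R y x)) (eqb-sym x y)
  ; adj-irrefl = λ x → irr x
  }
  where
  irr : ∀ x → (R x x ∨ R x x) ∧ not (eqb x x) ≡ false
  irr x with eqb x x | eqb-refl x
  ... | .true | refl = ∧-zeroʳ (R x x ∨ R x x)

-- Vertices of G ⊕ P: Fin (n + t); the first n are the old vertices V,
-- the last t are the new internal vertices w₁, …, w_t (w_{i+1} = raise n i).
-- Edge relation Q of the path P = (u, w₁, …, w_t, v).
pathRel : ∀ n t → Fin n → Fin n → Fin (n Data.Nat.+ t) → Fin (n Data.Nat.+ t) → Bool
pathRel n t u v x y with splitAt n x | splitAt n y
... | inj₁ a | inj₁ b = (t ≡ᵇ 0) ∧ eqb a u ∧ eqb b v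
... | inj₁ a | inj₂ j = eqb a u ∧ (toℕ j ≡ᵇ 0)
... | inj₂ i | inj₂ j = toℕ j ≡ᵇ suc (toℕ i)
... | inj₂ i | inj₁ b = eqb b v ∧ (suc (toℕ i) ≡ᵇ t)

IsNew : ∀ n t → Fin (n Data.Nat.+ t) → Set
IsNew n t x = ∃ λ (i : Fin t) → splitAt n x ≡ inj₂ i

Supplementary : ∀ n t → (Fin (n Data.Nat.+ t) → Fin (n Data.Nat.+ t) → Bool) → Set
Supplementary n t F = ∀ x y → F x y ≡ true → IsNew n t x ⊎ IsNew n t y

noEdges : ∀ {m} → Fin m → Fin m → Bool
noEdges _ _ = false

addPath : (G : Graph) → (u v : Fin (size G)) → (t : ℕ) →
          (Fin (size G Data.Nat.+ t) → Fin (size G Data.Nat.+ t) → Bool) → Graph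
addPath G u v t F = mkGraph (size G Data.Nat.+ t) R
  where
  R : Fin (size G Data.Nat.+ t) → Fin (size G Data.Nat.+ t) → Bool
  R x y with splitAt (size G) x | splitAt (size G) y
  ... | inj₁ a | inj₁ b = adj G a b ∨ pathRel (size G) t u v x y ∨ F x y
  ... | _      | _      = pathRel (size G) t u v x y ∨ F x y

-- P = (u, w₁, …, w_t, v) is a genuine path (u ≠ v), or, when u = v,
-- a cycle through u (t ≥ 2)
ValidPath : ∀ {n} → Fin n → Fin n → ℕ → Set
ValidPath u v t = u ≢ v ⊎ 2 ≤ t

-- length of P is t + 1; required to be at least |G| - 1
ClosedUnderPathAddition : GraphClass → Set
ClosedUnderPathAddition 𝒢 =
  (Hereditary 𝒢 ×
    (∀ G → 𝒢 G → ∀ u v t → ValidPath u v t → size G ∸ 1 ≤ suc t →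
       𝒢 (addPath G u v t noEdges)))
  ⊎
  (¬ Hereditary 𝒢 ×
    (∀ G → 𝒢 G → ∀ u v t → ValidPath u v t → size G ∸ 1 ≤ suc t →
       ∃ λ F → Supplementary (size G) t F × 𝒢 (addPath G u v t F)))

-- A class closed under path-addition that contains a graph with a vertex contains graphs with clique minors
-- of every order. Given a model of K_m, a long closed path through some vertex yields a new branch set; then,
-- for each old branch set c, a long path from the root of the new branch set to the root of c, whose internal
-- vertices join the new branch set, makes the two adjacent. Supplementary edges cannot spoil a minor model.
-- On the other hand a graph of treewidth at most k has no K_(k+2) minor: the bags meeting a connected branch
-- set form a subtree, adjacent branch sets give intersecting subtrees, and by the Helly property for subtrees
-- some bag meets all k + 2 branch sets, so it has at least k + 2 vertices.

module Submission where

open import Defs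
open import Data.Bool using (Bool; true; false; _∨_; _∧_; not)
open import Data.Bool.Properties using (T-≡)
open import Data.Empty using (⊥; ⊥-elim)
open import Data.Fin using (Fin; toℕ; fromℕ; fromℕ<; punchIn; punchOut; splitAt; join; _↑ˡ_; _↑ʳ_)
  renaming (zero to fzero; _≟_ to _≟ᶠ_)
open import Data.Fin.Properties
  using (any?; all?; ¬∀⟶∃¬; pigeonhole; toℕ≤pred[n]; toℕ<n; toℕ-injective; toℕ-fromℕ; toℕ-fromℕ<; fromℕ<-toℕ;
         punchOut-injective; punchIn-punchOut; punchIn-injective; punchInᵢ≢i;
         splitAt-↑ˡ; splitAt-↑ʳ; join-splitAt; ↑ˡ-injective; ↑ʳ-injective)
open import Data.Fin.Subset using (Subset; inside; ∣_∣) renaming (_∈_ to _∈ˢ_)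
open import Data.Fin.Subset.Properties using (drop-there; ∣p∣≤∣x∷p∣) renaming (_∈?_ to _∈ˢ?_)
open import Data.List using (List; []; _∷_; _++_; [_]; length)
open import Data.List.Relation.Unary.All using (All; []; _∷_)
open import Data.List.Relation.Unary.All.Properties using (¬Any⇒All¬)
open import Data.List.Relation.Unary.AllPairs using ([]; _∷_)
open import Data.List.Relation.Unary.Any using (here; there)
open import Data.List.Relation.Unary.Linked as Linked using (Linked; [-]; _∷_)
open import Data.List.Relation.Unary.Unique.Propositional using (Unique)
open import Data.Nat using (ℕ; zero; suc; _+_; _∸_; _≤_; _<_; z≤n; s≤s; s≤s⁻¹; _≡ᵇ_)
open import Data.Nat.Properties
  using (≤-refl; ≤-trans; <⇒≤; <-irrefl; ≤∧≢⇒<; n≤1+n; n<1+n; m≤m+n; m∸n≤m; suc-injective; 1+n≢n;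
         +-suc; +-identityʳ; m≤n⇒∃[o]m+o≡n; m≤n⇒m<n∨m≡n; ≡⇒≡ᵇ)
  renaming (_≟_ to _≟ℕ_)
open import Data.Product using (Σ; ∃; _×_; _,_; proj₁; proj₂)
open import Data.Sum using (_⊎_; inj₁; inj₂; [_,_]′)
open import Data.Vec using ([]; _∷_; here)
open import Function using (_∘_)
open import Function.Bundles using (Equivalence)
open import Function.Definitions using (Injective)
open import Relation.Binary.Construct.Closure.ReflexiveTransitive as Star using (Star; ε; _◅_; _◅◅_)
open import Relation.Nullary using (¬_; Dec; yes; no)
open import Relation.Nullary.Decidable using (_×-dec_)
open import Relation.Binary.PropositionalEquality using (_≡_; _≢_; refl; sym; trans; cong; subst)

-- Walks and loop erasure

module _ (G : Graph) where

  Edge-sym : ∀ {x y} → Edge G x y → Edge G y x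
  Edge-sym {x} {y} e = trans (adj-sym G y x) e

  Edge-irrefl : ∀ {x} → ¬ Edge G x x
  Edge-irrefl {x} e with trans (sym e) (adj-irrefl G x)
  ... | ()

  Edge⇒≢ : ∀ {x y} → Edge G x y → x ≢ y
  Edge⇒≢ e refl = Edge-irrefl e

  reach-head : ∀ {P x y} → Reach G P x y → P x
  reach-head (here p)     = p
  reach-head (step p _ _) = p

  reach-trans : ∀ {P x y z} → Reach G P x y → Reach G P y z → Reach G P x z
  reach-trans (here _)     r′ = r′
  reach-trans (step p e r) r′ = step p e (reach-trans r r′)

  reach-map : ∀ {P Q : Fin (size G) → Set} → (∀ {z} → P z → Q z) → ∀ {x y} → Reach G P x y → Reach G Q x y
  reach-map f (here p)     = here (f p)
  reach-map f (step p e r) = step (f p) e (reach-map f r)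

  reach-sym : ∀ {P x y} → Reach G P x y → Reach G P y x
  reach-sym r = go r (here (reach-head r))
    where
    go : ∀ {P a b c} → Reach G P a b → Reach G P a c → Reach G P b c
    go (here _)     acc = acc
    go (step _ e r) acc = go r (step (reach-head r) (Edge-sym e) acc)

  InsideEdge : (Fin (size G) → Set) → Fin (size G) → Fin (size G) → Set
  InsideEdge P x y = Edge G x y × P x × P y

  InsideEdge-sym : ∀ {P x y} → InsideEdge P x y → InsideEdge P y x
  InsideEdge-sym (e , p , q) = Edge-sym e , q , p

  inside-head : ∀ {P x y} → Star (InsideEdge P) x y → P y → P x
  inside-head ε                  py = py
  inside-head ((_ , px , _) ◅ _) _  = px

  reach⇒star : ∀ {P x y} → Reach G P x y → Star (InsideEdge P) x y
  reach⇒star (here _)     = ε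
  reach⇒star (step p e r) = (e , p , reach-head r) ◅ reach⇒star r

reach-hom : ∀ (G H : Graph) (f : Fin (size G) → Fin (size H)) → (∀ {a b} → Edge G a b → Edge H (f a) (f b)) →
            ∀ {P Q} → (∀ {z} → P z → Q (f z)) → ∀ {x y} → Reach G P x y → Reach H Q (f x) (f y)
reach-hom G H f f-edge f-pred (here p)     = here (f-pred p)
reach-hom G H f f-edge f-pred (step p e r) = step (f-pred p) (f-edge e) (reach-hom G H f f-edge f-pred r)

module _ {n : ℕ} where

  open import Data.List.Membership.DecPropositional (_≟ᶠ_ {n}) using (_∈_; _∈?_)

  data Last : List (Fin n) → Fin n → Set where
    end : ∀ b → Last [ b ] b
    _∷_ : ∀ {l b} x → Last l b → Last (x ∷ l) b

  SimplePath : (Fin n → Fin n → Set) → Fin n → Fin n → Set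
  SimplePath E a b = Σ (List (Fin n)) λ ys → Linked E (a ∷ ys) × Unique (a ∷ ys) × Last (a ∷ ys) b

  simplePath-from : ∀ {E a b L} → a ∈ L → Linked E L → Unique L → Last L b → SimplePath E a b
  simplePath-from {L = _ ∷ ys} (here refl) lk un ends = ys , lk , un , ends
  simplePath-from {L = _ ∷ []} (there ()) _ _ _
  simplePath-from {L = _ ∷ _ ∷ _} (there a∈) lk (_ ∷ un) (_ ∷ ends) =
    simplePath-from a∈ (Linked.tail lk) un ends

  erase : ∀ {E a b} → Star E a b → SimplePath E a b
  erase {b = b} ε = [] , [-] , [] ∷ [] , end b
  erase {a = a} (_◅_ {j = y} e w) with erase w
  ... | ys , lk , un , ends with a ∈? (y ∷ ys)
  ...   | yes a∈ = simplePath-from a∈ lk un ends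
  ...   | no  a∉ = y ∷ ys , e ∷ lk , ¬Any⇒All¬ (y ∷ ys) a∉ ∷ un , a ∷ ends

  linked-∷ʳ : ∀ {R : Fin n → Fin n → Set} {L b c} → Linked R L → Last L b → R b c → Linked R (L ++ [ c ])
  linked-∷ʳ [-]      (end _)    r = r ∷ [-]
  linked-∷ʳ (x ∷ lk) (_ ∷ ends) r = x ∷ linked-∷ʳ lk ends r

-- Trees

module Acyclic (T : Graph) (acyclic : ¬ HasCycle T) where

  V : Set
  V = Fin (size T)

  EdgeExcept : V → V → V → V → Set
  EdgeExcept a b x y = Edge T x y × (x ≡ a → y ≡ b → ⊥)

  edge-has-no-detour : ∀ {a b} → Edge T b a → ¬ SimplePath (EdgeExcept a b) a b
  edge-has-no-detour e ([]    , _          , _ , end _)     = Edge-irrefl T e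
  edge-has-no-detour e (_ ∷ [] , (e′ ∷ [-]) , _ , _ ∷ end _) = proj₂ e′ refl refl
  edge-has-no-detour {a} e (ys@(_ ∷ _ ∷ _) , lk , un , ends) =
    acyclic (a , ys , s≤s (s≤s z≤n) , un , linked-∷ʳ (Linked.map proj₁ lk) ends e)

  Avoiding : V → V → V → Set
  Avoiding s = InsideEdge T (_≢ s)

  avoids-or-leaves : ∀ {s a b} → Star (Edge T) a b → b ≢ s →
                     Star (Avoiding s) a b ⊎ ∃ λ s′ → Edge T s s′ × Star (Avoiding s) s′ b
  avoids-or-leaves ε _ = inj₁ ε
  avoids-or-leaves {s} {a} (e ◅ w) b≢s with avoids-or-leaves w b≢s
  ... | inj₂ leaves = inj₂ leaves
  ... | inj₁ avoids with a ≟ᶠ s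
  ...   | yes refl = inj₂ (_ , e , avoids)
  ...   | no  a≢s  = inj₁ ((e , a≢s , inside-head T avoids b≢s) ◅ avoids)

  module NonBacktracking (f : ℕ → V) (f-edge : ∀ k → Edge T (f k) (f (suc k)))
                         (f-nonbacktracking : ∀ k → f (suc (suc k)) ≢ f k) where

    segment : ℕ → ℕ → List V
    segment i zero    = []
    segment i (suc n) = f i ∷ segment (suc i) n

    length-segment : ∀ i n → length (segment i n) ≡ n
    length-segment i zero    = refl
    length-segment i (suc n) = cong suc (length-segment (suc i) n)

    All-segment : ∀ (P : V → Set) i n → (∀ a → i ≤ a → a < i + n → P (f a)) → All P (segment i n)
    All-segment P i zero    h = []
    All-segment P i (suc n) h rewrite +-suc i n =
      h i ≤-refl (s≤s (m≤m+n i n)) ∷ All-segment P (suc i) n (λ a i<a a<1+i+n → h a (<⇒≤ i<a) a<1+i+n)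

    segment-linked : ∀ i n → Linked (Edge T) (segment i n ++ [ f (i + n) ])
    segment-linked i zero          = [-]
    segment-linked i (suc zero)    rewrite +-suc i 0 | +-identityʳ i = f-edge i ∷ [-]
    segment-linked i (suc (suc n)) =
      f-edge i ∷ subst (λ k → Linked (Edge T) (segment (suc i) (suc n) ++ [ f k ])) (sym (+-suc i (suc n)))
                       (segment-linked (suc i) (suc n))

    segment-unique : ∀ i n → (∀ a b → i ≤ a → a < b → b < i + n → f a ≢ f b) → Unique (segment i n)
    segment-unique i zero    h = []
    segment-unique i (suc n) h rewrite +-suc i n =
      All-segment _ (suc i) n (λ a i<a a<n → h i a ≤-refl i<a a<n)
      ∷ segment-unique (suc i) n (λ a b i<a a<b b<n → h a b (<⇒≤ i<a) a<b b<n)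

    -- A repetition f a = f (1 + j) with f a, …, f j distinct closes a cycle, unless 1 + j - a ≤ 2, which
    -- would be a loop or a step straight back.
    distinct : ∀ j a b → a < b → b ≤ j → f a ≢ f b
    distinct (suc j) a b a<b (s≤s b≤j) with m≤n⇒m<n∨m≡n (s≤s b≤j)
    ... | inj₁ (s≤s b<1+j) = distinct j a b a<b b<1+j
    ... | inj₂ refl with m≤n⇒∃[o]m+o≡n (s≤s⁻¹ a<b)
    ...   | zero , refl rewrite +-identityʳ a = λ fa≡f1+a →
      Edge-irrefl T (subst (λ z → Edge T z (f (suc a))) fa≡f1+a (f-edge a))
    ...   | suc zero , refl rewrite +-suc a 0 | +-identityʳ a = λ fa≡f2+a → f-nonbacktracking a (sym fa≡f2+a)
    ...   | suc (suc d) , refl = λ fa≡f1+j →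
      acyclic (f a , segment (suc a) (2 + d)
              , subst (2 ≤_) (sym (length-segment (suc a) (2 + d))) (s≤s (s≤s z≤n))
              , segment-unique a (3 + d)
                  (λ x y _ x<y y<a+3+d → distinct j x y x<y (s≤s⁻¹ (subst (y <_) (+-suc a (2 + d)) y<a+3+d)))
              , subst (λ z → Linked (Edge T) (segment a (3 + d) ++ [ z ]))
                      (trans (cong f (+-suc a (2 + d))) (sym fa≡f1+j))
                      (segment-linked a (3 + d)))

    contradiction : ⊥
    contradiction with pigeonhole (n<1+n (size T)) (λ (i : Fin (suc (size T))) → f (toℕ i))
    ... | i , j , i<j , fi≡fj = distinct (size T) (toℕ i) (toℕ j) i<j (toℕ≤pred[n] j) fi≡fj

  no-nonbacktracking-sequence : (f : ℕ → V) → (∀ k → Edge T (f k) (f (suc k))) →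
                                (∀ k → f (suc (suc k)) ≢ f k) → ⊥
  no-nonbacktracking-sequence = NonBacktracking.contradiction

-- If no node lies in all the subtrees, step from each node s to its neighbour towards a subtree missing s.
-- Such steps never go straight back, which cannot go on forever in a finite tree.
module Helly (T : Graph) (isTree : IsTree T) {m : ℕ} (S : Fin m → Fin (size T) → Set)
             (S? : ∀ j s → Dec (S j s))
             (S-nonempty : ∀ j → ∃ (S j))
             (S-connected : ∀ j {s s′} → S j s → S j s′ → Reach T (S j) s s′)
             (S-meet : ∀ i j → ∃ λ s → S i s × S j s) where

  open Acyclic T (proj₂ (proj₂ isTree))

  StepAway : V → Set
  StepAway s = Σ V λ s′ → Edge T s s′ × Σ (Fin m) λ j → ¬ S j s × (∀ z → S j z → Star (Avoiding s) z s′)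

  stepAway : ∀ s j → ¬ S j s → StepAway s
  stepAway s j s∉Sj = leave (avoids-or-leaves (Star.map proj₁ (reach⇒star T (connected s z₀))) (∈⇒≢ z₀∈Sj))
    where
    connected : Connected T
    connected = proj₁ (proj₂ isTree)

    z₀ : V
    z₀ = proj₁ (S-nonempty j)

    z₀∈Sj : S j z₀
    z₀∈Sj = proj₂ (S-nonempty j)

    ∈⇒≢ : ∀ {x} → S j x → x ≢ s
    ∈⇒≢ x∈Sj x≡s = s∉Sj (subst (S j) x≡s x∈Sj)

    leave : Star (Avoiding s) s z₀ ⊎ (∃ λ s′ → Edge T s s′ × Star (Avoiding s) s′ z₀) → StepAway s
    leave (inj₁ avoids)       = ⊥-elim (inside-head T avoids (∈⇒≢ z₀∈Sj) refl)
    leave (inj₂ (s′ , e , w)) = s′ , e , j , s∉Sj , λ z z∈Sj →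
      Star.map (λ { (e , x∈ , y∈) → e , ∈⇒≢ x∈ , ∈⇒≢ y∈ }) (reach⇒star T (S-connected j z∈Sj z₀∈Sj))
      ◅◅ Star.reverse (InsideEdge-sym T) w

  -- Stepping away from s towards S j and then back from s′ towards S j′ would give, through a vertex of
  -- S j ∩ S j′, a second route between the adjacent vertices s and s′.
  stepAway-twice-≢ : ∀ s (away : StepAway s) (away′ : StepAway (proj₁ away)) → proj₁ away′ ≢ s
  stepAway-twice-≢ s (s′ , e , j , _ , toS′) (.s , _ , j′ , _ , toS) refl with S-meet j j′
  ... | z , z∈Sj , z∈Sj′ =
    edge-has-no-detour e
      (erase (Star.map (λ { (e , _ , y≢s) → e , λ _ → y≢s }) (Star.reverse (InsideEdge-sym T) (toS′ z z∈Sj))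
              ◅◅ Star.map (λ { (e , x≢s′ , _) → e , λ x≡s′ _ → x≢s′ x≡s′ }) (toS z z∈Sj′)))

  helly : ∃ λ s → ∀ j → S j s
  helly with any? (λ s → all? (λ j → S? j s))
  ... | yes common = common
  ... | no  none   = ⊥-elim (no-nonbacktracking-sequence walk (λ k → proj₁ (proj₂ (away (walk k))))
                               (λ k → stepAway-twice-≢ (walk k) (away (walk k)) (away (walk (suc k)))))
    where
    away : ∀ s → StepAway s
    away s with ¬∀⟶∃¬ m (λ j → S j s) (λ j → S? j s) (λ all → none (s , all))
    ... | j , s∉Sj = stepAway s j s∉Sj

    walk : ℕ → V
    walk zero    = fromℕ< (proj₁ isTree)
    walk (suc k) = proj₁ (away (walk k))

-- Clique minors

-- A labelling encodes branch sets: branch j consists of the vertices labelled suc j, and label 0 marks the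
-- vertices outside every branch set.
InBranch : (H : Graph) → (Fin (size H) → ℕ) → ℕ → Fin (size H) → Set
InBranch H label j x = label x ≡ suc j

BranchesConnected : (H : Graph) → (Fin (size H) → ℕ) → Set
BranchesConnected H label =
  ∀ j x y → InBranch H label j x → InBranch H label j y → Reach H (InBranch H label j) x y

BranchesAdjacent : (H : Graph) → (Fin (size H) → ℕ) → ℕ → ℕ → Set
BranchesAdjacent H label i j =
  Σ (Fin (size H)) λ x → Σ (Fin (size H)) λ y → InBranch H label i x × InBranch H label j y × Edge H x y

BranchesAdjacent-sym : ∀ {H label i j} → BranchesAdjacent H label i j → BranchesAdjacent H label j i
BranchesAdjacent-sym {H} (x , y , x∈ , y∈ , e) = y , x , y∈ , x∈ , Edge-sym H e

record CliqueModel (H : Graph) (m : ℕ) : Set where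
  field
    label             : Fin (size H) → ℕ
    root              : ℕ → Fin (size H)
    root-label        : ∀ j → j < m → InBranch H label j (root j)
    branch-connected  : BranchesConnected H label
    branches-adjacent : ∀ i j → i < m → j < m → i ≢ j → BranchesAdjacent H label i j
    label-bound       : ∀ x j → InBranch H label j x → j < m

injection-into-subset⇒≤ : ∀ {n m} (p : Subset n) (g : Fin m → Fin n) →
                           Injective _≡_ _≡_ g → (∀ j → g j ∈ˢ p) → m ≤ ∣ p ∣
injection-avoiding-0⇒≤ : ∀ {n m} b (p : Subset n) (g : Fin m → Fin (suc n)) → (∀ j → fzero ≢ g j) →
                          Injective _≡_ _≡_ g → (∀ j → g j ∈ˢ (b ∷ p)) → m ≤ ∣ p ∣

injection-into-subset⇒≤ {m = zero}  []      g g-inj g∈p = z≤n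
injection-into-subset⇒≤ {m = suc _} []      g g-inj g∈p with g fzero
... | ()
injection-into-subset⇒≤ (b ∷ p) g g-inj g∈p with any? (λ j → g j ≟ᶠ fzero)
... | no 0∉img =
  ≤-trans (injection-avoiding-0⇒≤ b p g (λ j 0≡gj → 0∉img (j , sym 0≡gj)) g-inj g∈p) (∣p∣≤∣x∷p∣ b p)
... | yes (j₀ , gj₀≡0) with subst (_∈ˢ (b ∷ p)) gj₀≡0 (g∈p j₀)
injection-into-subset⇒≤ {m = suc m} (.inside ∷ p) g g-inj g∈p | yes (j₀ , gj₀≡0) | here =
  s≤s (injection-avoiding-0⇒≤ inside p (g ∘ punchIn j₀)
         (λ k 0≡g → punchInᵢ≢i j₀ k (sym (g-inj (trans gj₀≡0 0≡g))))
         (λ {i} {j} eq → punchIn-injective j₀ i j (g-inj eq)) (g∈p ∘ punchIn j₀))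

injection-avoiding-0⇒≤ b p g 0≢g g-inj g∈p =
  injection-into-subset⇒≤ p (λ j → punchOut (0≢g j))
    (λ {i} {j} eq → g-inj (punchOut-injective (0≢g i) (0≢g j) eq))
    (λ j → drop-there (subst (_∈ˢ (b ∷ p)) (sym (punchIn-punchOut (0≢g j))) (g∈p j)))

module _ {H k} (td : TreeDecomposition H k) where

  open TreeDecomposition td

  MeetsBag : (Fin (size H) → Set) → Fin (size tree) → Set
  MeetsBag P s = Σ (Fin (size H)) λ x → P x × x ∈ˢ bag s

  bags-meeting-connected : ∀ {P x x′} → Reach H P x x′ → ∀ {s s′} → x ∈ˢ bag s → x′ ∈ˢ bag s′ →
                           Reach tree (MeetsBag P) s s′
  bags-meeting-connected {x = x} (here x∈P) {s} {s′} x∈s x∈s′ =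
    reach-map tree (λ x∈r → x , x∈P , x∈r) (connected-occurrences x s s′ x∈s x∈s′)
  bags-meeting-connected {x = x} (step {y = y} x∈P e r) {s} x∈s y∈s′ with covers-edges x y e
  ... | r₀ , x∈r₀ , y∈r₀ =
    reach-trans tree (reach-map tree (λ x∈r → x , x∈P , x∈r) (connected-occurrences x s r₀ x∈s x∈r₀))
                     (bags-meeting-connected r y∈r₀ y∈s′)

cliqueModel⇒≤ : ∀ {H k m} → TreeDecomposition H k → CliqueModel H m → m ≤ suc k
cliqueModel⇒≤ {H} {k} {m} td M = ≤-trans (injection-into-subset⇒≤ (bag s) g g-inj g∈bag) (width≤ s)
  where
  open TreeDecomposition td
  open CliqueModel M

  Meets : Fin m → Fin (size tree) → Set
  Meets j = MeetsBag td (InBranch H label (toℕ j))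

  Meets? : ∀ j s → Dec (Meets j s)
  Meets? j s = any? (λ x → (label x ≟ℕ suc (toℕ j)) ×-dec (x ∈ˢ? bag s))

  meets-somewhere : ∀ j → ∃ (Meets j)
  meets-somewhere j with covers-vertices (root (toℕ j))
  ... | s , root∈ = s , root (toℕ j) , root-label (toℕ j) (toℕ<n j) , root∈

  meet-together : ∀ i j → ∃ λ s → Meets i s × Meets j s
  meet-together i j with toℕ i ≟ℕ toℕ j
  ... | yes i≡j with toℕ-injective i≡j
  ...   | refl = let (s , meets) = meets-somewhere i in s , meets , meets
  meet-together i j | no i≢j with branches-adjacent (toℕ i) (toℕ j) (toℕ<n i) (toℕ<n j) i≢j
  ... | x , y , x∈ , y∈ , e with covers-edges x y e
  ...   | s , x∈s , y∈s = s , (x , x∈ , x∈s) , (y , y∈ , y∈s)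

  meets-connected : ∀ j {s s′} → Meets j s → Meets j s′ → Reach tree (Meets j) s s′
  meets-connected j (x , x∈ , x∈s) (x′ , x′∈ , x′∈s′) =
    bags-meeting-connected td (branch-connected (toℕ j) x x′ x∈ x′∈) x∈s x′∈s′

  common : ∃ λ s → ∀ j → Meets j s
  common = Helly.helly tree isTree Meets Meets? meets-somewhere meets-connected meet-together

  s : Fin (size tree)
  s = proj₁ common

  g : Fin m → Fin (size H)
  g j = proj₁ (proj₂ common j)

  g-inj : Injective _≡_ _≡_ g
  g-inj {i} {j} gi≡gj = toℕ-injective (suc-injective
    (trans (sym (proj₁ (proj₂ (proj₂ common i)))) (trans (cong label gi≡gj) (proj₁ (proj₂ (proj₂ common j))))))

  g∈bag : ∀ j → g j ∈ˢ bag s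
  g∈bag j = proj₂ (proj₂ (proj₂ common j))

-- Path addition

eqb-≢ : ∀ {n} {x y : Fin n} → x ≢ y → eqb x y ≡ false
eqb-≢ {x = x} {y} x≢y with x ≟ᶠ y
... | yes x≡y = ⊥-elim (x≢y x≡y)
... | no  _   = refl

symmetrised-edge : ∀ {r r′ d} → r ≡ true → d ≡ false → (r ∨ r′) ∧ not d ≡ true
symmetrised-edge refl refl = refl

∨-introˡ : ∀ {a b} → a ≡ true → a ∨ b ≡ true
∨-introˡ refl = refl

∧-intro : ∀ {a b} → a ≡ true → b ≡ true → a ∧ b ≡ true
∧-intro refl refl = refl

≡⇒≡ᵇ-true : ∀ {m n} → m ≡ n → (m ≡ᵇ n) ≡ true
≡⇒≡ᵇ-true {m} {n} eq = Equivalence.to T-≡ (≡⇒≡ᵇ m n eq)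

module PathAddition (H : Graph) (u v : Fin (size H)) (t′ : ℕ)
                    (F : Fin (size H + suc t′) → Fin (size H + suc t′) → Bool) where

  n t : ℕ
  n = size H
  t = suc t′

  H′ : Graph
  H′ = addPath H u v t F

  V′ : Set
  V′ = Fin (n + t)

  old : Fin n → V′
  old a = a ↑ˡ t

  new : Fin t → V′
  new i = n ↑ʳ i

  old≢new : ∀ a i → old a ≢ new i
  old≢new a i eq with trans (sym (splitAt-↑ˡ n a t)) (trans (cong (splitAt n) eq) (splitAt-↑ʳ n t i))
  ... | ()

  old-or-new : ∀ x → (∃ λ a → x ≡ old a) ⊎ (∃ λ i → x ≡ new i)
  old-or-new x with splitAt n x in eq
  ... | inj₁ a = inj₁ (a , trans (sym (join-splitAt n t x)) (cong (join n t) eq))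
  ... | inj₂ i = inj₂ (i , trans (sym (join-splitAt n t x)) (cong (join n t) eq))

  -- Each rewrite occurs twice: the adjacency of addPath symmetrises a relation defined by nested withs on
  -- both endpoints.
  old-edge : ∀ {a b} → Edge H a b → Edge H′ (old a) (old b)
  old-edge {a} {b} e rewrite splitAt-↑ˡ n a t | splitAt-↑ˡ n b t | splitAt-↑ˡ n a t | splitAt-↑ˡ n b t =
    symmetrised-edge (∨-introˡ e) (eqb-≢ (λ eq → Edge⇒≢ H e (↑ˡ-injective t a b eq)))

  path-edge : ∀ (i j : Fin t) → toℕ j ≡ suc (toℕ i) → Edge H′ (new i) (new j)
  path-edge i j j≡1+i rewrite splitAt-↑ʳ n t i | splitAt-↑ʳ n t j | splitAt-↑ʳ n t i | splitAt-↑ʳ n t j =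
    symmetrised-edge (∨-introˡ (≡⇒≡ᵇ-true j≡1+i)) (eqb-≢ (λ eq → i≢j (↑ʳ-injective n i j eq)))
    where
    i≢j : i ≢ j
    i≢j refl = 1+n≢n (sym j≡1+i)

  first-edge : Edge H′ (old u) (new fzero)
  first-edge
    rewrite splitAt-↑ˡ n u t | splitAt-↑ʳ n t (fzero {t′}) | splitAt-↑ˡ n u t | splitAt-↑ʳ n t (fzero {t′}) =
    symmetrised-edge (∨-introˡ (∧-intro (eqb-refl u) refl)) (eqb-≢ (old≢new u fzero))

  last-edge : Edge H′ (new (fromℕ t′)) (old v)
  last-edge
    rewrite splitAt-↑ˡ n v t | splitAt-↑ʳ n t (fromℕ t′) | splitAt-↑ˡ n v t | splitAt-↑ʳ n t (fromℕ t′) =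
    symmetrised-edge (∨-introˡ (∧-intro (eqb-refl v) (≡⇒≡ᵇ-true (cong suc (toℕ-fromℕ t′)))))
                     (eqb-≢ (λ eq → old≢new v (fromℕ t′) (sym eq)))

  module NewBranch (label : Fin n → ℕ) (m : ℕ) where

    label′ : V′ → ℕ
    label′ x = [ label , (λ _ → suc m) ]′ (splitAt n x)

    label′-old : ∀ a → label′ (old a) ≡ label a
    label′-old a rewrite splitAt-↑ˡ n a t = refl

    label′-new : ∀ i → label′ (new i) ≡ suc m
    label′-new i rewrite splitAt-↑ʳ n t i = refl

    InBranch′ : ℕ → V′ → Set
    InBranch′ = InBranch H′ label′

    new-reaches-first : ∀ i → Reach H′ (InBranch′ m) (new i) (new fzero)
    new-reaches-first i = subst (λ k → Reach H′ (InBranch′ m) (new k) (new fzero)) (fromℕ<-toℕ i (toℕ<n i))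
                                (along (toℕ i) (toℕ<n i))
      where
      along : ∀ k (k<t : k < t) → Reach H′ (InBranch′ m) (new (fromℕ< k<t)) (new fzero)
      along zero    _   = here (label′-new fzero)
      along (suc k) k<t =
        step (label′-new _) (Edge-sym H′ (path-edge (fromℕ< k<t′) (fromℕ< k<t) 1+k≡)) (along k k<t′)
        where
        k<t′ : k < t
        k<t′ = ≤-trans (n≤1+n (suc k)) k<t
        1+k≡ : toℕ (fromℕ< k<t) ≡ suc (toℕ (fromℕ< k<t′))
        1+k≡ = trans (toℕ-fromℕ< k<t) (cong suc (sym (toℕ-fromℕ< k<t′)))

    old-∈ : ∀ {j a} → InBranch H label j a → InBranch′ j (old a)
    old-∈ {a = a} a∈ = trans (label′-old a) a∈

    ∈-old : ∀ {j a} → InBranch′ j (old a) → InBranch H label j a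
    ∈-old {a = a} a∈ = trans (sym (label′-old a)) a∈

    lift-reach : ∀ {j a b} → Reach H (InBranch H label j) a b → Reach H′ (InBranch′ j) (old a) (old b)
    lift-reach = reach-hom H H′ old old-edge old-∈

    lift-adjacent : ∀ {i j} → BranchesAdjacent H label i j → BranchesAdjacent H′ label′ i j
    lift-adjacent (x , y , x∈ , y∈ , e) = old x , old y , old-∈ x∈ , old-∈ y∈ , old-edge e

    lift-connected : BranchesConnected H label → (hub : V′) →
                     (∀ x → InBranch′ m x → Reach H′ (InBranch′ m) x hub) → BranchesConnected H′ label′
    lift-connected connected hub to-hub j x y x∈ y∈ with j ≟ℕ m
    ... | yes refl = reach-trans H′ (to-hub x x∈) (reach-sym H′ (to-hub y y∈))
    ... | no  j≢m with old-or-new x | old-or-new y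
    ...   | inj₂ (i , refl) | _               = ⊥-elim (j≢m (suc-injective (trans (sym x∈) (label′-new i))))
    ...   | inj₁ _          | inj₂ (i , refl) = ⊥-elim (j≢m (suc-injective (trans (sym y∈) (label′-new i))))
    ...   | inj₁ (a , refl) | inj₁ (b , refl) = lift-reach (connected j a b (∈-old x∈) (∈-old y∈))

    lift-label-bound : (∀ x j → InBranch H label j x → j ≤ m) → ∀ x j → InBranch′ j x → j ≤ m
    lift-label-bound bound x j x∈ with old-or-new x
    ... | inj₂ (i , refl) = subst (_≤ m) (suc-injective (trans (sym (label′-new i)) x∈)) ≤-refl
    ... | inj₁ (a , refl) = bound a j (∈-old x∈)

-- A model of the complete graph on the branches 0, …, m in which branch m need not yet be adjacent to the
-- branches c, …, m - 1.
record PartialCliqueModel (H : Graph) (m c : ℕ) : Set where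
  field
    label            : Fin (size H) → ℕ
    root             : ℕ → Fin (size H)
    root-label       : ∀ j → j ≤ m → InBranch H label j (root j)
    branch-connected : BranchesConnected H label
    old-adjacent     : ∀ i j → i < m → j < m → i ≢ j → BranchesAdjacent H label i j
    new-adjacent     : ∀ i → i < c → BranchesAdjacent H label m i
    label-bound      : ∀ x j → InBranch H label j x → j ≤ m

-- The new vertices of a closed path through x₀ form branch m.
add-branch : ∀ {H m} → CliqueModel H m → (x₀ : Fin (size H)) → ∀ F →
             PartialCliqueModel (addPath H x₀ x₀ (suc (suc (size H))) F) m 0
add-branch {H} {m} M x₀ F = record
  { label            = label′
  ; root             = root′
  ; root-label       = root′-label
  ; branch-connected = lift-connected branch-connected (new fzero) to-hub
  ; old-adjacent     = λ i j i<m j<m i≢j → lift-adjacent (branches-adjacent i j i<m j<m i≢j)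
  ; new-adjacent     = λ _ ()
  ; label-bound      = lift-label-bound (λ x j x∈ → <⇒≤ (label-bound x j x∈))
  }
  where
  open CliqueModel M
  open PathAddition H x₀ x₀ (suc (size H)) F
  open NewBranch label m

  root′ : ℕ → V′
  root′ j with j ≟ℕ m
  ... | yes _ = new fzero
  ... | no  _ = old (root j)

  root′-label : ∀ j → j ≤ m → InBranch′ j (root′ j)
  root′-label j j≤m with j ≟ℕ m
  ... | yes refl = label′-new fzero
  ... | no  j≢m  = old-∈ (root-label j (≤∧≢⇒< j≤m j≢m))

  to-hub : ∀ x → InBranch′ m x → Reach H′ (InBranch′ m) x (new fzero)
  to-hub x x∈ with old-or-new x
  ... | inj₂ (i , refl) = new-reaches-first i
  ... | inj₁ (a , refl) = ⊥-elim (<-irrefl refl (label-bound a m (∈-old x∈)))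

-- The new vertices of a path from the root of branch m to the root of branch c join branch m.
connect-branch : ∀ {H m c} (P : PartialCliqueModel H m c) → c < m → ∀ F →
                 let open PartialCliqueModel P in
                 PartialCliqueModel (addPath H (root m) (root c) (suc (size H)) F) m (suc c)
connect-branch {H} {m} {c} P c<m F = record
  { label            = label′
  ; root             = old ∘ root
  ; root-label       = λ j j≤m → old-∈ (root-label j j≤m)
  ; branch-connected = lift-connected branch-connected (old (root m)) to-hub
  ; old-adjacent     = λ i j i<m j<m i≢j → lift-adjacent (old-adjacent i j i<m j<m i≢j)
  ; new-adjacent     = new-adjacent′
  ; label-bound      = lift-label-bound label-bound
  }
  where
  open PartialCliqueModel P
  open PathAddition H (root m) (root c) (size H) F
  open NewBranch label m

  to-hub : ∀ x → InBranch′ m x → Reach H′ (InBranch′ m) x (old (root m))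
  to-hub x x∈ with old-or-new x
  ... | inj₂ (i , refl) =
    reach-trans H′ (new-reaches-first i)
                   (step (label′-new fzero) (Edge-sym H′ first-edge) (here (old-∈ (root-label m ≤-refl))))
  ... | inj₁ (a , refl) = lift-reach (branch-connected m a (root m) (∈-old x∈) (root-label m ≤-refl))

  new-adjacent′ : ∀ i → i < suc c → BranchesAdjacent H′ label′ m i
  new-adjacent′ i (s≤s i≤c) with m≤n⇒m<n∨m≡n i≤c
  ... | inj₁ i<c  = lift-adjacent (new-adjacent i i<c)
  ... | inj₂ refl =
    new (fromℕ (size H)) , old (root i) , label′-new _ , old-∈ (root-label i (<⇒≤ c<m)) , last-edge

roots-distinct : ∀ {H m c} (P : PartialCliqueModel H m c) → c < m →
                 let open PartialCliqueModel P in root m ≢ root c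
roots-distinct {m = m} {c} P c<m root-m≡root-c = <-irrefl (suc-injective c≡m) c<m
  where
  open PartialCliqueModel P
  c≡m : suc c ≡ suc m
  c≡m = trans (sym (root-label c (<⇒≤ c<m))) (trans (cong label (sym root-m≡root-c)) (root-label m ≤-refl))

complete : ∀ {H m} → PartialCliqueModel H m m → CliqueModel H (suc m)
complete {H} {m} P = record
  { label             = label
  ; root              = root
  ; root-label        = λ j j<1+m → root-label j (s≤s⁻¹ j<1+m)
  ; branch-connected  = branch-connected
  ; branches-adjacent = adjacent
  ; label-bound       = λ x j x∈ → s≤s (label-bound x j x∈)
  }
  where
  open PartialCliqueModel P

  adjacent : ∀ i j → i < suc m → j < suc m → i ≢ j → BranchesAdjacent H label i j
  adjacent i j (s≤s i≤m) (s≤s j≤m) i≢j with i ≟ℕ m | j ≟ℕ m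
  ... | yes refl | yes refl = ⊥-elim (i≢j refl)
  ... | yes refl | no  j≢m  = new-adjacent j (≤∧≢⇒< j≤m j≢m)
  ... | no  i≢m  | yes refl = BranchesAdjacent-sym {H} (new-adjacent i (≤∧≢⇒< i≤m i≢m))
  ... | no  i≢m  | no  j≢m  = old-adjacent i j (≤∧≢⇒< i≤m i≢m) (≤∧≢⇒< j≤m j≢m) i≢j

PathExtensible : GraphClass → Set
PathExtensible 𝒢 =
  ∀ G → 𝒢 G → ∀ u v t → ValidPath u v t → size G ∸ 1 ≤ suc t → ∃ λ F → 𝒢 (addPath G u v t F)

closed⇒pathExtensible : ∀ {𝒢} → ClosedUnderPathAddition 𝒢 → PathExtensible 𝒢
closed⇒pathExtensible (inj₁ (_ , closed)) G G∈ u v t valid long = noEdges , closed G G∈ u v t valid long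
closed⇒pathExtensible (inj₂ (_ , closed)) G G∈ u v t valid long with closed G G∈ u v t valid long
... | F , _ , G′∈ = F , G′∈

long-enough : ∀ {n t} → n ≤ t → n ∸ 1 ≤ suc t
long-enough {n} {t} n≤t = ≤-trans (m∸n≤m n 1) (≤-trans n≤t (n≤1+n t))

module _ {𝒢 : GraphClass} (extend : PathExtensible 𝒢) where

  connect-all : ∀ {H m} → 𝒢 H → PartialCliqueModel H m 0 → ∀ c → c ≤ m →
                ∃ λ H′ → 𝒢 H′ × PartialCliqueModel H′ m c
  connect-all H∈ P zero    _   = _ , H∈ , P
  connect-all {m = m} H∈ P (suc c) c<m with connect-all H∈ P c (<⇒≤ c<m)
  ... | H₁ , H₁∈ , P₁
    with extend H₁ H₁∈ (PartialCliqueModel.root P₁ m) (PartialCliqueModel.root P₁ c) (suc (size H₁))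
                (inj₁ (roots-distinct P₁ c<m)) (long-enough (n≤1+n _))
  ...   | F , H₂∈ = _ , H₂∈ , connect-branch P₁ c<m F

  cliqueModel : ∀ {G} → 𝒢 G → Fin (size G) → ∀ m → ∃ λ H → 𝒢 H × Fin (size H) × CliqueModel H m
  cliqueModel {G} G∈ x₀ zero = G , G∈ , x₀ , record
    { label = λ _ → 0 ; root = λ _ → x₀ ; root-label = λ _ () ; branch-connected = λ _ _ _ ()
    ; branches-adjacent = λ _ _ () ; label-bound = λ _ _ () }
  cliqueModel G∈ x₀ (suc m) with cliqueModel G∈ x₀ m
  ... | H , H∈ , x , M
    with extend H H∈ x x (suc (suc (size H))) (inj₂ (s≤s (s≤s z≤n))) (long-enough (≤-trans (n≤1+n _) (n≤1+n _)))
  ...   | F , H₁∈ with connect-all H₁∈ (add-branch M x F) m ≤-refl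
  ...     | H₂ , H₂∈ , P = H₂ , H₂∈ , PartialCliqueModel.root P 0 , complete P

¬Fin⇒≡0 : ∀ {n} → ¬ Fin n → n ≡ 0
¬Fin⇒≡0 {zero}  _    = refl
¬Fin⇒≡0 {suc n} ¬fin = ⊥-elim (¬fin fzero)

corollary3 : (𝒢 : GraphClass) → IsoClosed 𝒢 → Nontrivial 𝒢 →
    BoundedTreewidth 𝒢 → ¬ ClosedUnderPathAddition 𝒢
corollary3 𝒢 _ (_ , not-only-empty , _) (k , tw≤k) closed = not-only-empty (λ G G∈ → ¬Fin⇒≡0 (no-vertex G∈))
  where
  too-large : ¬ (∃ λ H → 𝒢 H × Fin (size H) × CliqueModel H (2 + k))
  too-large (H , H∈ , _ , M) = <-irrefl refl (cliqueModel⇒≤ (tw≤k H H∈) M)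

  no-vertex : ∀ {G} → 𝒢 G → ¬ Fin (size G)
  no-vertex G∈ x₀ = too-large (cliqueModel (closed⇒pathExtensible closed) G∈ x₀ (2 + k))
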